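{- Let $\{q_n\}_{n\ge1}$ be the Fibonacci Quilt sequence. Then (1) for all $n\geq 6$, $q_{n+1}=q_n+q_{n-4}$; (2) for all $n\geq 5$, $q_{n+1}=q_{n-1}+q_{n-2}$; (3) for all $n\ge1$, $\sum_{i=1}^n q_i=q_{n+5}-6$.
   Context: Given an increasing sequence of positive integers $\{q_i\}_{i\ge1}$, a decomposition $m=q_{\ell_1}+q_{\ell_2}+\cdots+q_{\ell_t}$ with $q_{\ell_1}>q_{\ell_2}>\cdots>q_{\ell_t}$ is called FQ-legal if $|\ell_i-\ell_j|\notin\{0,1,3,4\}$ for all $i\neq j$, and $\{1,3\}\not\subset\{\ell_1,\dots,\ell_t\}$. The Fibonacci Quilt sequence is the increasing sequence of positive integers $\{q_i\}_{i\ge1}$ in which each $q_i$ is the smallest positive integer that has no FQ-legal decomposition using elements of $\{q_1,\dots,q_{i-1}\}$. Its first terms are $1,2,3,4,5,7,9,12,16,21,28,\dots$. -}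

module Defs where

open import Data.Nat using (ℕ; zero; suc; _+_; _≤_; _<_; ∣_-_∣)
open import Data.List using (List; map)
open import Data.Nat.ListAction using (sum)
open import Data.List.Relation.Unary.All using (All)
open import Data.List.Relation.Unary.AllPairs using (AllPairs)
open import Data.List.Membership.Propositional using (_∈_)
open import Data.Product using (Σ; _×_)
open import Relation.Nullary using (¬_)
open import Relation.Binary.PropositionalEquality using (_≡_; _≢_)

-- Sequences are indexed from 1: q 1, q 2, ... (the value q 0 is irrelevant).

Compatible : ℕ → ℕ → Set
Compatible a b =
  ∣ a - b ∣ ≢ 0 × ∣ a - b ∣ ≢ 1 × ∣ a - b ∣ ≢ 3 × ∣ a - b ∣ ≢ 4

FQLegal : (ℕ → ℕ) → ℕ → ℕ → Set
FQLegal q i m =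
  Σ (List ℕ) λ ℓs →
    All (λ ℓ → 1 ≤ ℓ × ℓ < i) ℓs ×
    AllPairs Compatible ℓs ×
    ¬ (1 ∈ ℓs × 3 ∈ ℓs) ×
    sum (map q ℓs) ≡ m

IsFibonacciQuilt : (ℕ → ℕ) → Set
IsFibonacciQuilt q =
  (i : ℕ) → 1 ≤ i →
    (1 ≤ q i) ×
    ¬ FQLegal q i (q i) ×
    ((m : ℕ) → 1 ≤ m → m < q i → FQLegal q i m)

sumTo : (ℕ → ℕ) → ℕ → ℕ
sumTo q zero = 0
sumTo q (suc n) = sumTo q n + q (suc n)

module Submission where

-- The candidate is `quilt`, given by its first terms and quilt (n+7) = quilt (n+6) + quilt (n+2);
-- it also satisfies the Fibonacci-type recurrence quilt (n+5) = quilt (n+3) + quilt (n+2).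
-- The defining property determines a sequence uniquely (compare q n and r n by strong
-- induction: the smaller one would be decomposable for both), so it suffices to show that
-- quilt has it. Every m < quilt i decomposes greedily. That quilt i itself has no legal
-- decomposition into earlier terms follows from a stronger invariant, proved by strong
-- induction on the largest admissible index k: a legal sum of terms of index at most k is
-- below quilt (k+3) and differs from quilt (k+1) and quilt (k+2). Removing the top index k,
-- and k−2 if it also occurs, leaves a legal set of indices at most k−5, resp. k−7.

open import Defs
open import Algebra.Properties.CommutativeSemigroup as CommSemigroup using ()
open import Data.Empty using (⊥-elim)
open import Data.List using (List; []; _∷_; _++_; map)
open import Data.List.Membership.Propositional using (_∈_; _∉_)
open import Data.List.Membership.Propositional.Properties using (∈-∃++)
open import Data.List.Properties using (map-cong-local)
open import Data.List.Relation.Binary.Permutation.Propositional using (_↭_; ↭-sym; ↭-prep; ↭⇒↭ₛ)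
open import Data.List.Relation.Binary.Permutation.Propositional.Properties
  using (All-resp-↭; ∈-resp-↭; shift; map⁺)
open import Data.List.Relation.Binary.Permutation.Setoid.Properties as Setoid↭ using ()
open import Data.List.Relation.Unary.All as All using (All; []; _∷_)
open import Data.List.Relation.Unary.AllPairs using (AllPairs; []; _∷_)
open import Data.List.Relation.Unary.Any using (here; there)
open import Data.Nat
  using (ℕ; zero; suc; _+_; _∸_; _≤_; _<_; _≤′_; ≤′-refl; ≤′-step; z≤n; s≤s; z<s; _≟_; _<?_)
open import Data.List.Membership.DecPropositional _≟_ using (_∈?_)
open import Data.Nat.Induction using (<-rec)
open import Data.Nat.ListAction using (sum)
open import Data.Nat.ListAction.Properties using (sum-↭)
open import Data.Nat.Properties
open import Data.Product using (_×_; _,_; proj₁; proj₂; ∃; map₂)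
open import Data.Sum using (_⊎_; inj₁; inj₂; [_,_]′)
open import Function using (_∘_)
open import Relation.Binary.PropositionalEquality
open import Relation.Nullary using (¬_; ¬?; Dec; _×-dec_)
open import Relation.Nullary.Decidable using (from-yes; toSum; yes; no)

open CommSemigroup +-commutativeSemigroup using (interchange; xy∙z≈xz∙y)

quilt : ℕ → ℕ
quilt 0 = 0
quilt 1 = 1
quilt 2 = 2
quilt 3 = 3
quilt 4 = 4
quilt 5 = 5
quilt 6 = 7
quilt (suc (suc (suc (suc (suc (suc (suc n))))))) =
  quilt (suc (suc (suc (suc (suc (suc n)))))) + quilt (suc (suc n))

quilt-<-suc : ∀ n → quilt n < quilt (suc n)
quilt-<-suc 0 = n<1+n 0
quilt-<-suc 1 = n<1+n 1
quilt-<-suc 2 = n<1+n 2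
quilt-<-suc 3 = n<1+n 3
quilt-<-suc 4 = n<1+n 4
quilt-<-suc 5 = m<m+n 5 z<s
quilt-<-suc (suc (suc (suc (suc (suc (suc n)))))) =
  m<m+n (quilt (6 + n)) (≤-<-trans z≤n (quilt-<-suc (suc n)))

quilt-mono-< : ∀ {m n} → m < n → quilt m < quilt n
quilt-mono-< {m} m<n = go (≤⇒≤′ m<n)
  where
    go : ∀ {n} → suc m ≤′ n → quilt m < quilt n
    go ≤′-refl         = quilt-<-suc m
    go (≤′-step {n} p) = <-trans (go p) (quilt-<-suc n)

quilt-positive : ∀ {n} → 1 ≤ n → 1 ≤ quilt n
quilt-positive {suc n} _ = ≤-<-trans (z≤n {quilt n}) (quilt-<-suc n)

quilt-fibonacci : ∀ n → quilt (5 + n) ≡ quilt (3 + n) + quilt (2 + n)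
quilt-fibonacci 0 = refl
quilt-fibonacci 1 = refl
quilt-fibonacci 2 = refl
quilt-fibonacci 3 = refl
quilt-fibonacci 4 = refl
quilt-fibonacci (suc (suc (suc (suc (suc j))))) = begin
  quilt (9 + j) + quilt (5 + j)
    ≡⟨ cong₂ _+_ (quilt-fibonacci (suc (suc (suc (suc j))))) (quilt-fibonacci j) ⟩
  (quilt (7 + j) + quilt (6 + j)) + (quilt (3 + j) + quilt (2 + j))
    ≡⟨ interchange (quilt (7 + j)) _ _ _ ⟩
  quilt (8 + j) + quilt (7 + j)
    ∎
  where open ≡-Reasoning

quilt-sumTo : ∀ n → sumTo quilt (suc n) + 6 ≡ quilt (6 + n)
quilt-sumTo zero    = refl
quilt-sumTo (suc n) = begin
  sumTo quilt (suc n) + quilt (2 + n) + 6 ≡⟨ xy∙z≈xz∙y (sumTo quilt (suc n)) _ _ ⟩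
  sumTo quilt (suc n) + 6 + quilt (2 + n) ≡⟨ cong (_+ quilt (2 + n)) (quilt-sumTo n) ⟩
  quilt (6 + n) + quilt (2 + n)           ∎
  where open ≡-Reasoning

Admissible : ℕ → ℕ → Set
Admissible k s = s < quilt (3 + k) × s ≢ quilt (1 + k) × s ≢ quilt (2 + k)

admissible? : ∀ k s → Dec (Admissible k s)
admissible? k s = s <? quilt (3 + k) ×-dec ¬? (s ≟ quilt (1 + k)) ×-dec ¬? (s ≟ quilt (2 + k))

admissible-zero : ∀ {s} → Admissible 0 s → s ≡ 0
admissible-zero {0}                 _              = refl
admissible-zero {1}                 (_ , s≢1 , _)  = ⊥-elim (s≢1 refl)
admissible-zero {2}                 (_ , _ , s≢2)  = ⊥-elim (s≢2 refl)
admissible-zero {suc (suc (suc _))} (s≤s (s≤s (s≤s ())) , _)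

admissible-suc : ∀ {k s} → Admissible k s → Admissible (suc k) s
admissible-suc {k} (s<q₃ , _ , s≢q₂) = <-trans s<q₃ (quilt-<-suc (3 + k)) , s≢q₂ , <⇒≢ s<q₃

admissible-cons : ∀ k {s} → Admissible (k ∸ 5) s → Admissible k (quilt k + s)
admissible-cons 0 a = a
admissible-cons 1 a rewrite admissible-zero a = from-yes (admissible? 1 1)
admissible-cons 2 a rewrite admissible-zero a = from-yes (admissible? 2 2)
admissible-cons 3 a rewrite admissible-zero a = from-yes (admissible? 3 3)
admissible-cons 4 a rewrite admissible-zero a = from-yes (admissible? 4 4)
admissible-cons 5 a rewrite admissible-zero a = from-yes (admissible? 5 5)
admissible-cons (suc (suc (suc (suc (suc (suc j)))))) {s} (s<q₄ , s≢q₂ , _) = below , ≢q₇ , ≢q₈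
  where
    ≢q₇ : quilt (6 + j) + s ≢ quilt (7 + j)
    ≢q₇ = s≢q₂ ∘ +-cancelˡ-≡ (quilt (6 + j)) s _
    ≢q₈ : quilt (6 + j) + s ≢ quilt (8 + j)
    ≢q₈ e = <⇒≢ (+-monoʳ-< (quilt (6 + j)) (<-trans s<q₄ (quilt-<-suc (4 + j))))
                (trans e (quilt-fibonacci (3 + j)))
    below : quilt (6 + j) + s < quilt (9 + j)
    below = begin-strict
      quilt (6 + j) + s
        <⟨ +-monoʳ-< (quilt (6 + j)) (<-trans s<q₄ (quilt-mono-< (m≤n+m (5 + j) 2))) ⟩
      quilt (6 + j) + quilt (7 + j) ≡⟨ +-comm (quilt (6 + j)) _ ⟩
      quilt (7 + j) + quilt (6 + j) ≡⟨ quilt-fibonacci (4 + j) ⟨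
      quilt (9 + j)                 ∎
      where open ≤-Reasoning

admissible-cons₂ : ∀ m {s} → 2 ≤ m → Admissible (m ∸ 5) s →
                   Admissible (2 + m) (quilt (2 + m) + (quilt m + s))
admissible-cons₂ 1 (s≤s ()) _
admissible-cons₂ 2 _ a rewrite admissible-zero a = from-yes (admissible? 4 6)
admissible-cons₂ 3 _ a rewrite admissible-zero a = from-yes (admissible? 5 8)
admissible-cons₂ 4 _ a rewrite admissible-zero a = from-yes (admissible? 6 11)
admissible-cons₂ 5 _ a rewrite admissible-zero a = from-yes (admissible? 7 14)
admissible-cons₂ (suc (suc (suc (suc (suc (suc j)))))) {s} _ (s<q₄ , s≢q₂ , _) =
  below , ≢q₉ , ≢q₁₀
  where
    ≢q₉ : quilt (8 + j) + (quilt (6 + j) + s) ≢ quilt (9 + j)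
    ≢q₉ e = <⇒≢ (<-≤-trans (quilt-mono-< (m≤n+m (5 + j) 1)) (m≤m+n _ s))
                (sym (+-cancelˡ-≡ (quilt (8 + j)) _ _ e))
    ≢q₁₀ : quilt (8 + j) + (quilt (6 + j) + s) ≢ quilt (10 + j)
    ≢q₁₀ e = s≢q₂ (+-cancelˡ-≡ (quilt (6 + j)) s _
                    (+-cancelˡ-≡ (quilt (8 + j)) _ _ (trans e (quilt-fibonacci (5 + j)))))
    below : quilt (8 + j) + (quilt (6 + j) + s) < quilt (11 + j)
    below = begin-strict
      quilt (8 + j) + (quilt (6 + j) + s)
        <⟨ +-monoʳ-< (quilt (8 + j)) (+-monoʳ-< (quilt (6 + j)) (<-trans s<q₄ (quilt-mono-< (m≤n+m (5 + j) 2)))) ⟩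
      quilt (8 + j) + (quilt (6 + j) + quilt (7 + j)) ≡⟨ cong (quilt (8 + j) +_) (+-comm (quilt (6 + j)) _) ⟩
      quilt (8 + j) + (quilt (7 + j) + quilt (6 + j)) ≡⟨ +-assoc (quilt (8 + j)) _ _ ⟨
      quilt (8 + j) + quilt (7 + j) + quilt (6 + j)   ≡⟨ cong (_+ quilt (6 + j)) (quilt-fibonacci (5 + j)) ⟨
      quilt (11 + j)                                  ∎
      where open ≤-Reasoning

LegalDistance : ℕ → Set
LegalDistance d = d ≢ 0 × d ≢ 1 × d ≢ 3 × d ≢ 4

legalDistance-cases : ∀ {d} → LegalDistance d → d ≡ 2 ⊎ 5 ≤ d
legalDistance-cases {0}                             (≢0 , _)          = ⊥-elim (≢0 refl)
legalDistance-cases {1}                             (_ , ≢1 , _)      = ⊥-elim (≢1 refl)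
legalDistance-cases {2}                             _                 = inj₁ refl
legalDistance-cases {3}                             (_ , _ , ≢3 , _)  = ⊥-elim (≢3 refl)
legalDistance-cases {4}                             (_ , _ , _ , ≢4)  = ⊥-elim (≢4 refl)
legalDistance-cases {suc (suc (suc (suc (suc d))))} _                 = inj₂ (m≤m+n 5 d)

compatible-sym : ∀ {m n} → Compatible m n → Compatible n m
compatible-sym {m} {n} = subst LegalDistance (∣-∣-comm m n)

compatible-below : ∀ {k ℓ} → ℓ ≤ k → Compatible k ℓ → k ≡ 2 + ℓ ⊎ 5 + ℓ ≤ k
compatible-below {k} {ℓ} ℓ≤k c with legalDistance-cases (subst LegalDistance (m≤n⇒∣n-m∣≡n∸m ℓ≤k) c)
... | inj₁ d≡2 = inj₁ (trans (sym (m∸n+n≡m ℓ≤k)) (cong (_+ ℓ) d≡2))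
... | inj₂ 5≤d = inj₂ (subst (5 + ℓ ≤_) (m∸n+n≡m ℓ≤k) (+-monoˡ-≤ ℓ 5≤d))

compatible-below₂ : ∀ {m ℓ} → ℓ ≤ 2 + m → Compatible (2 + m) ℓ → Compatible m ℓ → 5 + ℓ ≤ m
compatible-below₂ {m} {ℓ} ℓ≤2+m c₁ c₂ with compatible-below ℓ≤2+m c₁
... | inj₁ refl      = ⊥-elim (proj₁ c₂ (∣n-n∣≡0 ℓ))
... | inj₂ 5+ℓ≤2+m with compatible-below (≤-trans (m≤n+m ℓ 3) (≤-pred (≤-pred 5+ℓ≤2+m))) c₂
...   | inj₁ refl    = ⊥-elim (n≮n (4 + ℓ) 5+ℓ≤2+m)
...   | inj₂ 5+ℓ≤m   = 5+ℓ≤m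

legalDistance-≥5 : ∀ {d} → 5 ≤ d → LegalDistance d
legalDistance-≥5 (s≤s (s≤s (s≤s (s≤s (s≤s _))))) = (λ ()) , (λ ()) , (λ ()) , (λ ())

compatible-distant : ∀ {k ℓ} → 5 + ℓ ≤ k → Compatible k ℓ
compatible-distant {k} {ℓ} 5+ℓ≤k =
  subst LegalDistance (sym (m≤n⇒∣n-m∣≡n∸m (≤-trans (m≤n+m ℓ 5) 5+ℓ≤k)))
    (legalDistance-≥5 (m+n≤o⇒m≤o∸n 5 5+ℓ≤k))

Legal : ℕ → List ℕ → Set
Legal k ℓs = All (λ ℓ → 1 ≤ ℓ × ℓ ≤ k) ℓs × AllPairs Compatible ℓs × ¬ (1 ∈ ℓs × 3 ∈ ℓs)

legal-resp-↭ : ∀ {k ℓs ℓs′} → ℓs ↭ ℓs′ → Legal k ℓs → Legal k ℓs′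
legal-resp-↭ σ (bounds , pairs , no13) =
    All-resp-↭ σ bounds
  , Setoid↭.AllPairs-resp-↭ (setoid ℕ) (λ {m} {n} → compatible-sym {m} {n}) (resp₂ Compatible) (↭⇒↭ₛ σ) pairs
  , λ (1∈ , 3∈) → no13 (∈-resp-↭ (↭-sym σ) 1∈ , ∈-resp-↭ (↭-sym σ) 3∈)

legal-tail : ∀ {k ℓ ℓs} → Legal k (ℓ ∷ ℓs) → Legal k ℓs
legal-tail (_ ∷ bounds , _ ∷ pairs , no13) = bounds , pairs , λ (1∈ , 3∈) → no13 (there 1∈ , there 3∈)

legal-lower : ∀ {j k ℓs} → (∀ {ℓ} → ℓ ∈ ℓs → ℓ ≤ j) → Legal k ℓs → Legal j ℓs
legal-lower bound (bounds , pairs , no13) =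
  All.tabulate (λ ℓ∈ → proj₁ (All.lookup bounds ℓ∈) , bound ℓ∈) , pairs , no13

legal-pred : ∀ {k ℓs} → suc k ∉ ℓs → Legal (suc k) ℓs → Legal k ℓs
legal-pred k∉ legal@(bounds , _) =
  legal-lower (λ ℓ∈ → ≤-pred (≤∧≢⇒< (proj₂ (All.lookup bounds ℓ∈)) λ { refl → k∉ ℓ∈ })) legal

legal-drop-top : ∀ {k ℓs} → k ∸ 2 ∉ ℓs → Legal k (k ∷ ℓs) → Legal (k ∸ 5) ℓs
legal-drop-top {k} {ℓs} k-2∉ legal@(_ ∷ bounds , compat ∷ _ , _) = legal-lower bound (legal-tail legal)
  where
    bound : ∀ {ℓ} → ℓ ∈ ℓs → ℓ ≤ k ∸ 5
    bound ℓ∈ with compatible-below (proj₂ (All.lookup bounds ℓ∈)) (All.lookup compat ℓ∈)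
    ... | inj₁ k≡2+ℓ = ⊥-elim (k-2∉ (subst (_∈ ℓs) (sym (cong (_∸ 2) k≡2+ℓ)) ℓ∈))
    ... | inj₂ 5+ℓ≤k = ∸-monoˡ-≤ 5 5+ℓ≤k

legal-drop-top₂ : ∀ {m ℓs} → Legal (2 + m) (2 + m ∷ m ∷ ℓs) → Legal (m ∸ 5) ℓs
legal-drop-top₂ {m} {ℓs} legal@(_ ∷ _ ∷ bounds , (_ ∷ compat₁) ∷ compat₂ ∷ _ , _) =
  legal-lower bound (legal-tail (legal-tail legal))
  where
    bound : ∀ {ℓ} → ℓ ∈ ℓs → ℓ ≤ m ∸ 5
    bound ℓ∈ = ∸-monoˡ-≤ 5
      (compatible-below₂ (proj₂ (All.lookup bounds ℓ∈)) (All.lookup compat₁ ℓ∈) (All.lookup compat₂ ℓ∈))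

∈⇒↭∷ : ∀ {A : Set} {x : A} {xs} → x ∈ xs → ∃ λ ys → xs ↭ x ∷ ys
∈⇒↭∷ x∈ with ys , zs , refl ← ∈-∃++ x∈ = ys ++ zs , shift _ ys zs

sum-map-↭ : ∀ {A : Set} (f : A → ℕ) {xs ys} → xs ↭ ys → sum (map f xs) ≡ sum (map f ys)
sum-map-↭ f σ = sum-↭ (map⁺ f σ)

LegalSumsAdmissible : ℕ → Set
LegalSumsAdmissible k = ∀ {ℓs} → Legal k ℓs → Admissible k (sum (map quilt ℓs))

legal-sum-admissible-top₂ : ∀ m → (∀ {j} → j < 2 + m → LegalSumsAdmissible j) →
                            ∀ {ℓs} → Legal (2 + m) (2 + m ∷ m ∷ ℓs) →
                            Admissible (2 + m) (quilt (2 + m) + (quilt m + sum (map quilt ℓs)))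
legal-sum-admissible-top₂ 0 _ (_ ∷ (() , _) ∷ _ , _)
legal-sum-admissible-top₂ 1 _ (_ , _ , no13) = ⊥-elim (no13 (there (here refl) , here refl))
legal-sum-admissible-top₂ m@(suc (suc _)) ih legal =
  admissible-cons₂ m (s≤s (s≤s z≤n)) (ih (s≤s (m≤n⇒m≤1+n (m∸n≤m m 5))) (legal-drop-top₂ legal))

legal-sum-admissible-top : ∀ k → (∀ {j} → j < suc k → LegalSumsAdmissible j) →
                           ∀ {ℓs} → Legal (suc k) (suc k ∷ ℓs) →
                           Admissible (suc k) (quilt (suc k) + sum (map quilt ℓs))
legal-sum-admissible-top k ih {ℓs} legal with suc k ∸ 2 ∈? ℓs
... | no k-1∉ = admissible-cons (suc k) (ih (s≤s (m∸n≤m k 4)) (legal-drop-top k-1∉ legal))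
legal-sum-admissible-top zero _ (_ ∷ bounds , _) | yes 0∈ with () ← proj₁ (All.lookup bounds 0∈)
legal-sum-admissible-top (suc m) ih {ℓs} legal | yes m∈ with ℓs′ , σ ← ∈⇒↭∷ m∈ =
  subst (λ t → Admissible (2 + m) (quilt (2 + m) + t)) (sym (sum-map-↭ quilt σ))
    (legal-sum-admissible-top₂ m ih (legal-resp-↭ (↭-prep _ σ) legal))

legal-sum-admissible : ∀ k → LegalSumsAdmissible k
legal-sum-admissible = <-rec LegalSumsAdmissible step
  where
    step : ∀ k → (∀ {j} → j < k → LegalSumsAdmissible j) → LegalSumsAdmissible k
    step zero    _  {[]}    _                     = from-yes (admissible? 0 0)
    step zero    _  {_ ∷ _} ((1≤ℓ , ℓ≤0) ∷ _ , _) with () ← ≤-trans 1≤ℓ ℓ≤0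
    step (suc k) ih {ℓs} legal with suc k ∈? ℓs
    ... | no  k∉ = admissible-suc {k} (ih ≤-refl (legal-pred k∉ legal))
    ... | yes k∈ with ℓs′ , σ ← ∈⇒↭∷ k∈ =
      subst (Admissible (suc k)) (sym (sum-map-↭ quilt σ))
        (legal-sum-admissible-top k ih (legal-resp-↭ σ legal))

quilt-not-decomposable : ∀ {i} → 1 ≤ i → ¬ FQLegal quilt i (quilt i)
quilt-not-decomposable {suc k} _ (ℓs , bounds , pairs , no13 , sum≡) =
  proj₁ (proj₂ (legal-sum-admissible k (All.map (map₂ ≤-pred) bounds , pairs , no13))) sum≡

fqLegal-weaken : ∀ {q i m} → FQLegal q i m → FQLegal q (suc i) m
fqLegal-weaken (ℓs , bounds , rest) = ℓs , All.map (map₂ m<n⇒m<1+n) bounds , rest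

fqLegal-cons : ∀ {q i j m} → 4 + j ≤ i → FQLegal q j m → FQLegal q (suc i) (q i + m)
fqLegal-cons {q} {i} {j} 4+j≤i (ℓs , bounds , pairs , no13 , sum≡) =
    i ∷ ℓs
  , (≤-trans (s≤s z≤n) 4+j≤i , ≤-refl) ∷ All.map (map₂ λ ℓ<j → ≤-trans ℓ<j j≤1+i) bounds
  , All.map (λ (_ , ℓ<j) → compatible-distant (≤-trans (+-monoʳ-≤ 4 ℓ<j) 4+j≤i)) bounds ∷ pairs
  , (λ { (here 1≡i , _) → <⇒≢ (≤-trans (m≤m+n 2 (2 + j)) 4+j≤i) 1≡i
       ; (there _ , here 3≡i) → <⇒≢ (≤-trans (m≤m+n 4 j) 4+j≤i) 3≡i
       ; (there 1∈ , there 3∈) → no13 (1∈ , 3∈) })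
  , cong (q i +_) sum≡
  where
    j≤1+i : j ≤ suc i
    j≤1+i = m≤n⇒m≤1+n (≤-trans (m≤n+m j 4) 4+j≤i)

fqLegal-singleton : ∀ {i m} → 1 ≤ m → m ≤ 5 → m < i → FQLegal quilt i m
fqLegal-singleton {m = m} 1≤m m≤5 m<i =
    m ∷ [] , (1≤m , m<i) ∷ [] , [] ∷ [] , (λ { (here refl , here ()) })
  , trans (+-identityʳ (quilt m)) (quilt-small m≤5)
  where
    quilt-small : ∀ {m} → m ≤ 5 → quilt m ≡ m
    quilt-small {0} _ = refl
    quilt-small {1} _ = refl
    quilt-small {2} _ = refl
    quilt-small {3} _ = refl
    quilt-small {4} _ = refl
    quilt-small {5} _ = refl
    quilt-small {suc (suc (suc (suc (suc (suc _)))))} (s≤s (s≤s (s≤s (s≤s (s≤s ())))))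

quilt-decomposable : ∀ i m → m < quilt i → FQLegal quilt i m
quilt-decomposable (suc n@(suc (suc (suc (suc (suc (suc j))))))) m m<qₙ₊₁ =
  [ (λ m<qₙ → fqLegal-weaken (quilt-decomposable n m m<qₙ))
  , (λ m≮qₙ → let qₙ≤m = ≮⇒≥ m≮qₙ in
       subst (FQLegal quilt (suc n)) (m+[n∸m]≡n qₙ≤m)
         (fqLegal-cons ≤-refl (quilt-decomposable (suc (suc j)) (m ∸ quilt n) (rest< qₙ≤m))))
  ]′ (toSum (m <? quilt n))
  where
    rest< : quilt n ≤ m → m ∸ quilt n < quilt (2 + j)
    rest< qₙ≤m = +-cancelˡ-< (quilt n) _ _ (subst (_< quilt (suc n)) (sym (m+[n∸m]≡n qₙ≤m)) m<qₙ₊₁)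
quilt-decomposable _ 0 _ = [] , [] , [] , (λ { (() , _) }) , refl
quilt-decomposable 1 (suc m) (s≤s ())
quilt-decomposable 2 m@(suc _) m<2 = fqLegal-singleton (s≤s z≤n) (≤-trans (<⇒≤ m<2) (m≤m+n 2 3)) m<2
quilt-decomposable 3 m@(suc _) m<3 = fqLegal-singleton (s≤s z≤n) (≤-trans (<⇒≤ m<3) (m≤m+n 3 2)) m<3
quilt-decomposable 4 m@(suc _) m<4 = fqLegal-singleton (s≤s z≤n) (≤-trans (<⇒≤ m<4) (m≤m+n 4 1)) m<4
quilt-decomposable 5 m@(suc _) m<5 = fqLegal-singleton (s≤s z≤n) (<⇒≤ m<5) m<5
quilt-decomposable 6 m@(suc _) m<7 with m ≟ 6
... | yes refl =
  4 ∷ 2 ∷ [] , (s≤s z≤n , m≤n+m 5 1) ∷ (s≤s z≤n , m≤n+m 3 3) ∷ []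
  , (((λ ()) , (λ ()) , (λ ()) , (λ ())) ∷ []) ∷ [] ∷ []
  , (λ { (here () , _) ; (there (here ()) , _) ; (there (there ()) , _) })
  , refl
... | no m≢6 = fqLegal-singleton (s≤s z≤n) (≤-pred m<6) m<6
  where
    m<6 : m < 6
    m<6 = ≤∧≢⇒< (≤-pred m<7) m≢6

quilt-isFibonacciQuilt : IsFibonacciQuilt quilt
quilt-isFibonacciQuilt i 1≤i =
  quilt-positive 1≤i , quilt-not-decomposable 1≤i , λ m _ m<qᵢ → quilt-decomposable i m m<qᵢ

fqLegal-cong : ∀ {q r i m} → (∀ {j} → 1 ≤ j → j < i → q j ≡ r j) → FQLegal q i m → FQLegal r i m
fqLegal-cong {q} {r} {i} q≡r (ℓs , bounds , pairs , no13 , sum≡) =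
  ℓs , bounds , pairs , no13 , trans (cong sum (map-cong-local r≡q)) sum≡
  where
    r≡q : All (λ ℓ → r ℓ ≡ q ℓ) ℓs
    r≡q = All.map (λ (1≤ℓ , ℓ<i) → sym (q≡r 1≤ℓ ℓ<i)) bounds

isFibonacciQuilt-≮ : ∀ {q r} → IsFibonacciQuilt q → IsFibonacciQuilt r →
                     ∀ {n} → 1 ≤ n → (∀ {j} → 1 ≤ j → j < n → q j ≡ r j) → ¬ q n < r n
isFibonacciQuilt-≮ {q} {r} isQ isR {n} 1≤n q≡r qₙ<rₙ =
  proj₁ (proj₂ (isQ n 1≤n))
    (fqLegal-cong (λ 1≤j j<n → sym (q≡r 1≤j j<n))
      (proj₂ (proj₂ (isR n 1≤n)) (q n) (proj₁ (isQ n 1≤n)) qₙ<rₙ))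

isFibonacciQuilt-unique : ∀ {q r} → IsFibonacciQuilt q → IsFibonacciQuilt r → ∀ n → 1 ≤ n → q n ≡ r n
isFibonacciQuilt-unique {q} {r} isQ isR = <-rec (λ n → 1 ≤ n → q n ≡ r n) agree
  where
    agree : ∀ n → (∀ {j} → j < n → 1 ≤ j → q j ≡ r j) → 1 ≤ n → q n ≡ r n
    agree n ih 1≤n = ≤-antisym
      (≮⇒≥ (isFibonacciQuilt-≮ isR isQ 1≤n λ 1≤j j<n → sym (ih j<n 1≤j)))
      (≮⇒≥ (isFibonacciQuilt-≮ isQ isR 1≤n λ 1≤j j<n → ih j<n 1≤j))

sumTo-cong : ∀ {q r} → (∀ {j} → 1 ≤ j → q j ≡ r j) → ∀ n → sumTo q n ≡ sumTo r n
sumTo-cong q≡r zero    = refl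
sumTo-cong q≡r (suc n) = cong₂ _+_ (sumTo-cong q≡r n) (q≡r (s≤s z≤n))

theorem1p7 : (q : ℕ → ℕ) → IsFibonacciQuilt q →
    ((n : ℕ) → 6 ≤ n → q (n + 1) ≡ q n + q (n ∸ 4)) ×
    ((n : ℕ) → 5 ≤ n → q (n + 1) ≡ q (n ∸ 1) + q (n ∸ 2)) ×
    ((n : ℕ) → 1 ≤ n → sumTo q n + 6 ≡ q (n + 5))
theorem1p7 q isFQ = recurrence₁ , recurrence₂ , partialSums
  where
    q≡quilt : ∀ {n} → 1 ≤ n → q n ≡ quilt n
    q≡quilt {n} = isFibonacciQuilt-unique isFQ quilt-isFibonacciQuilt n

    q-+1 : ∀ n → q (n + 1) ≡ quilt (suc n)
    q-+1 n = trans (cong q (+-comm n 1)) (q≡quilt (s≤s z≤n))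

    recurrence₁ : (n : ℕ) → 6 ≤ n → q (n + 1) ≡ q n + q (n ∸ 4)
    recurrence₁ n 6≤n with j , refl ← m≤n⇒∃[o]m+o≡n 6≤n =
      trans (q-+1 (6 + j)) (sym (cong₂ _+_ (q≡quilt (s≤s z≤n)) (q≡quilt (s≤s z≤n))))

    recurrence₂ : (n : ℕ) → 5 ≤ n → q (n + 1) ≡ q (n ∸ 1) + q (n ∸ 2)
    recurrence₂ n 5≤n with j , refl ← m≤n⇒∃[o]m+o≡n 5≤n =
      trans (q-+1 (5 + j))
        (trans (quilt-fibonacci (suc j)) (sym (cong₂ _+_ (q≡quilt (s≤s z≤n)) (q≡quilt (s≤s z≤n)))))

    partialSums : (n : ℕ) → 1 ≤ n → sumTo q n + 6 ≡ q (n + 5)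
    partialSums (suc k) _ = begin
      sumTo q (suc k) + 6     ≡⟨ cong (_+ 6) (sumTo-cong q≡quilt (suc k)) ⟩
      sumTo quilt (suc k) + 6 ≡⟨ quilt-sumTo k ⟩
      quilt (6 + k)           ≡⟨ q≡quilt (s≤s z≤n) ⟨
      q (6 + k)               ≡⟨ cong q (+-comm 5 (suc k)) ⟩
      q (suc k + 5)           ∎
      where open ≡-Reasoning
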